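{- If positive integers $n,g,h$ with $g\ge h$ satisfy $\binom{n}{g}>n^h$ and $g>\sqrt{n(g-h)}$, then, writing $\alpha=g/h$ and $\beta=n/h$, one has $\alpha\ge 88/87$ and $\beta-\alpha<88$.
   Context: $\binom{n}{g}$ is the binomial coefficient. -}

module Defs where

{-# OPTIONS --safe #-}
module Submission where

-- Write g = h + d. Since (n C g) * g ! ≤ n ^ g, the hypothesis n ^ h < n C g gives
-- g ! < n ^ d, so d ≥ 1 and n ≤ n d < g². If h were at least 7 d, then
-- m = g ∸ 3 d ≥ g / 2 and g ≥ 8, whence g² ≤ m³ and
-- n ^ d ≤ (g²) ^ d ≤ m ^ (3 d) ≤ g !, a contradiction. Hence h < 7 d ≤ 87 d, which
-- is the first bound; the second follows from n d < (h + d)² by expanding the square.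

open import Defs
open import Data.Nat using (ℕ; _+_; _*_; _∸_; _^_; _≤_; _<_; _≥_; _>_)
open import Data.Nat.Combinatorics using (_C_)
open import Data.Product using (_×_)

open import Data.Nat.Base using (zero; suc; _≤ᵇ_; _!; z≤n; s≤s)
open import Data.Nat.Properties
open import Data.Nat.Combinatorics using (nCk≡nPk/k!; k>n⇒nCk≡0)
open import Data.Nat.Combinatorics.Base using (_P_; _P′_)
open import Data.Nat.DivMod using (_/_; m/n*n≤m)
open import Data.Nat.Solver using (module +-*-Solver)
open import Data.Bool.Base using (true; false)
open import Data.Product using (_,_)
open import Relation.Nullary using (yes; no; contradiction)
open import Relation.Binary.PropositionalEquality using (_≡_; refl; sym; cong)

open +-*-Solver

nP′k≤n^k : ∀ n k → n P′ k ≤ n ^ k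
nP′k≤n^k n zero    = ≤-refl
nP′k≤n^k n (suc k) = *-mono-≤ (m∸n≤m n k) (nP′k≤n^k n k)

nPk≤n^k : ∀ n k → n P k ≤ n ^ k
nPk≤n^k n k with k ≤ᵇ n
... | true  = nP′k≤n^k n k
... | false = z≤n

nCk*k!≤n^k : ∀ n k → (n C k) * k ! ≤ n ^ k
nCk*k!≤n^k n k with k ≤? n
... | no k≰n rewrite k>n⇒nCk≡0 (≰⇒> k≰n) = z≤n
... | yes k≤n = begin
  (n C k) * k !                    ≡⟨ cong (_* k !) (nCk≡nPk/k! k≤n) ⟩
  ((n P k) / k !) * k !            ≤⟨ m/n*n≤m (n P k) (k !) ⟩
  n P k                            ≤⟨ nPk≤n^k n k ⟩
  n ^ k                            ∎
  where
  open ≤-Reasoning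
  instance _ = k !≢0

m^k≤[k+m]! : ∀ m k → m ^ k ≤ (k + m) !
m^k≤[k+m]! m zero    = 1≤n! m
m^k≤[k+m]! m (suc k) = *-mono-≤ (m≤n+m m (suc k)) (m^k≤[k+m]! m k)

n^h<nC[h+d]⇒[h+d]!<n^d : ∀ n h d → n ^ h < n C (h + d) → (h + d) ! < n ^ d
n^h<nC[h+d]⇒[h+d]!<n^d n h d binom = *-cancelˡ-< (n ^ h) _ _ (begin-strict
  n ^ h * (h + d) !          <⟨ *-monoˡ-< ((h + d) !) {{(h + d) !≢0}} binom ⟩
  (n C (h + d)) * (h + d) !  ≤⟨ nCk*k!≤n^k n (h + d) ⟩
  n ^ (h + d)                ≡⟨ ^-distribˡ-+-* n h d ⟩
  n ^ h * n ^ d              ∎)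
  where open ≤-Reasoning

g*g≤m^3 : ∀ {g m} → 8 ≤ g → g ≤ 2 * m → g * g ≤ m ^ 3
g*g≤m^3 {g} {m} 8≤g g≤2m = *-cancelˡ-≤ 8 (begin
  8 * (g * g)                  ≤⟨ *-monoˡ-≤ (g * g) 8≤g ⟩
  g * (g * g)                  ≤⟨ *-mono-≤ g≤2m (*-mono-≤ g≤2m g≤2m) ⟩
  2 * m * (2 * m * (2 * m))    ≡⟨ solve 1 (λ x → con 2 :* x :* (con 2 :* x :* (con 2 :* x))
                                                  := con 8 :* x :^ 3) refl m ⟩
  8 * m ^ 3                    ∎)
  where open ≤-Reasoning

[g*g]^d≤g! : ∀ {d g} → 1 ≤ d → 8 * d ≤ g → (g * g) ^ d ≤ g !
[g*g]^d≤g! {d} {g} 1≤d 8d≤g = begin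
  (g * g) ^ d        ≤⟨ ^-monoˡ-≤ d (g*g≤m^3 {g} {m} 8≤g g≤2m) ⟩
  (m ^ 3) ^ d        ≡⟨ ^-*-assoc m 3 d ⟩
  m ^ (3 * d)        ≤⟨ m^k≤[k+m]! m (3 * d) ⟩
  (3 * d + m) !      ≡⟨ cong _! g≡3d+m ⟩
  g !                ∎
  where
  open ≤-Reasoning
  m : ℕ
  m = g ∸ 3 * d
  3d+3d≤g : 3 * d + 3 * d ≤ g
  3d+3d≤g = begin
    3 * d + 3 * d  ≡⟨ *-distribʳ-+ d 3 3 ⟨
    6 * d          ≤⟨ *-monoˡ-≤ d (m≤m+n 6 2) ⟩
    8 * d          ≤⟨ 8d≤g ⟩
    g              ∎
  g≡3d+m : 3 * d + m ≡ g
  g≡3d+m = m+[n∸m]≡n (≤-trans (m≤m+n (3 * d) (3 * d)) 3d+3d≤g)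
  3d≤m : 3 * d ≤ m
  3d≤m = ≤-trans (≤-reflexive (sym (m+n∸n≡m (3 * d) (3 * d)))) (∸-monoˡ-≤ (3 * d) 3d+3d≤g)
  g≤2m : g ≤ 2 * m
  g≤2m = begin
    g            ≡⟨ sym g≡3d+m ⟩
    3 * d + m    ≤⟨ +-monoˡ-≤ m 3d≤m ⟩
    m + m        ≡⟨ cong (m +_) (sym (+-identityʳ m)) ⟩
    2 * m        ∎
  8≤g : 8 ≤ g
  8≤g = ≤-trans (*-monoʳ-≤ 8 1≤d) 8d≤g

h<7d : ∀ n h d → n ^ h < n C (h + d) → n * d < (h + d) * (h + d) → h < 7 * d
h<7d n h zero binom _ = contradiction (1≤n! (h + 0)) (<⇒≱ (n^h<nC[h+d]⇒[h+d]!<n^d n h 0 binom))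
h<7d n h d@(suc _) binom sq with h <? 7 * d
... | yes h<7d = h<7d
... | no h≮7d = contradiction n^d≤g! (<⇒≱ (n^h<nC[h+d]⇒[h+d]!<n^d n h d binom))
  where
  open ≤-Reasoning
  g : ℕ
  g = h + d
  8d≤g : 8 * d ≤ g
  8d≤g = begin
    8 * d          ≡⟨ *-distribʳ-+ d 7 1 ⟩
    7 * d + 1 * d  ≡⟨ cong (7 * d +_) (*-identityˡ d) ⟩
    7 * d + d      ≤⟨ +-monoˡ-≤ d (≮⇒≥ h≮7d) ⟩
    g              ∎
  n≤g*g : n ≤ g * g
  n≤g*g = <⇒≤ (≤-<-trans (m≤m*n n d) sq)
  n^d≤g! : n ^ d ≤ g !
  n^d≤g! = ≤-trans (^-monoˡ-≤ d n≤g*g) ([g*g]^d≤g! (s≤s z≤n) 8d≤g)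

h≤k*d⇒[1+k]*h≤k*[h+d] : ∀ k h d → h ≤ k * d → suc k * h ≤ k * (h + d)
h≤k*d⇒[1+k]*h≤k*[h+d] k h d h≤kd = begin
  h + k * h      ≤⟨ +-monoˡ-≤ (k * h) h≤kd ⟩
  k * d + k * h  ≡⟨ +-comm (k * d) (k * h) ⟩
  k * h + k * d  ≡⟨ *-distribˡ-+ k h d ⟨
  k * (h + d)    ∎
  where open ≤-Reasoning

-- Otherwise n d ≥ (h + d + (1 + k) h) d, and comparing with (h + d)² leaves k d h < h h.
h≤k*d⇒n<h+d+[1+k]*h : ∀ k n h d → h ≤ k * d → n * d < (h + d) * (h + d) → n < h + d + suc k * h
h≤k*d⇒n<h+d+[1+k]*h k n h d h≤kd sq with n <? h + d + suc k * h
... | yes n<bound = n<bound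
... | no n≮bound = contradiction h≤kd (<⇒≱ kd<h)
  where
  open ≤-Reasoning
  X : ℕ
  X = d * d + 2 * (h * d)
  X+kd*h<X+h*h : X + k * d * h < X + h * h
  X+kd*h<X+h*h = begin-strict
    X + k * d * h               ≡⟨ solve 3 (λ k h d → d :* d :+ con 2 :* (h :* d) :+ k :* d :* h
                                                 := (h :+ d :+ (con 1 :+ k) :* h) :* d) refl k h d ⟩
    (h + d + suc k * h) * d     ≤⟨ *-monoˡ-≤ d (≮⇒≥ n≮bound) ⟩
    n * d                       <⟨ sq ⟩
    (h + d) * (h + d)           ≡⟨ solve 2 (λ h d → (h :+ d) :* (h :+ d)
                                                 := d :* d :+ con 2 :* (h :* d) :+ h :* h) refl h d ⟩
    X + h * h                   ∎
  kd<h : k * d < h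
  kd<h = *-cancelʳ-< h (k * d) h (+-cancelˡ-< X _ _ X+kd*h<X+h*h)

mainTheorem6 : (n g h : ℕ) → 1 ≤ n → 1 ≤ g → 1 ≤ h → g ≥ h →
    n ^ h < n C g →
    n * (g ∸ h) < g * g →
    (88 * h ≤ 87 * g) × (n < g + 88 * h)
mainTheorem6 n g h _ _ _ h≤g = bounds (m+[n∸m]≡n h≤g)
  where
  bounds : ∀ {g′ d} → h + d ≡ g′ → n ^ h < n C g′ → n * d < g′ * g′ →
           (88 * h ≤ 87 * g′) × (n < g′ + 88 * h)
  bounds {d = d} refl binom sq =
    h≤k*d⇒[1+k]*h≤k*[h+d] 87 h d h≤87d , h≤k*d⇒n<h+d+[1+k]*h 87 n h d h≤87d sq
    where
    h≤87d : h ≤ 87 * d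
    h≤87d = ≤-trans (<⇒≤ (h<7d n h d binom sq)) (*-monoˡ-≤ d (m≤m+n 7 80))
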